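{- Let $d$ be a positive integer and let $\Sigma$ be a triangulation of $\Delta_{d-1}\times\Delta_{d-1}=\operatorname{conv}\{(e_j,e_i):j,i\in[d]\}\subseteq\mathbb R^{2d}$. Let $g\in\mathbb R^{2d}$ be the barycentre, all of whose coordinates equal $1/d$. Then the bipartite graph corresponding to the minimal cell of $\Sigma$ (with respect to inclusion) containing $g$ is a perfect matching on $[d]\sqcup[d]$.
   Context: Cells of the triangulation are simplices whose vertices are among the points $(e_j,e_i)$. The bipartite graph on $L\sqcup R$ (with $L=\{\ell_1,\dots,\ell_d\}$, $R=\{r_1,\dots,r_d\}$, both identified with $[d]$) corresponding to a simplex with vertices $(e_{j_1},e_{i_1}),\dots,(e_{j_k},e_{i_k})$ has edges $(\ell_{j_1},r_{i_1}),\dots,(\ell_{j_k},r_{i_k})$.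
   Formalization: Points lie in ℚ^(2d) instead of ℝ^(2d) and convex and affine coefficients are rational, so affine independence, the triangulation conditions on Σ and minimality of the cell containing g are taken over ℚ. -}

module Defs where

open import Data.Nat using (ℕ; NonZero)
open import Data.Fin using (Fin; zero; suc)
open import Data.Integer using (+_)
open import Data.Rational using (ℚ; 0ℚ; 1ℚ; _+_; _≤_; _/_)
open import Data.Bool using (Bool; true; false)
open import Data.Product using (Σ; ∃; _×_; _,_)
open import Relation.Binary.PropositionalEquality using (_≡_)

∑ : ∀ {n} → (Fin n → ℚ) → ℚ
∑ {ℕ.zero} f = 0ℚ
∑ {ℕ.suc n} f = f zero + ∑ (λ i → f (suc i))

-- A set of vertices (e_j , e_i) of Δ_{d-1} × Δ_{d-1}, i.e. a subset of
-- [d] × [d].  Equivalently the edge set of a bipartite graph on L ⊔ R: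
-- E j i ≡ true  iff  (e_j , e_i) is a vertex  iff  (ℓ_j , r_i) is an edge.
VertexSet : ℕ → Set
VertexSet d = Fin d → Fin d → Bool

_⊆_ : ∀ {d} → VertexSet d → VertexSet d → Set
E ⊆ F = ∀ j i → E j i ≡ true → F j i ≡ true

_∧ˢ_ : ∀ {d} → VertexSet d → VertexSet d → VertexSet d
(E ∧ˢ F) j i with E j i
... | true = F j i
... | false = false

-- A point of ℚ^{2d}: first block of d coordinates, second block of d.
Point : ℕ → Set
Point d = (Fin d → ℚ) × (Fin d → ℚ)

-- p ∈ conv { (e_j , e_i) : E j i ≡ true }
InConv : ∀ {d} → VertexSet d → Point d → Set
InConv {d} E (p , q) =
  Σ (Fin d → Fin d → ℚ) λ λ' →
    (∀ j i → 0ℚ ≤ λ' j i) ×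
    (∀ j i → E j i ≡ false → λ' j i ≡ 0ℚ) ×
    (∑ (λ j → ∑ (λ i → λ' j i)) ≡ 1ℚ) ×
    (∀ j → ∑ (λ i → λ' j i) ≡ p j) ×
    (∀ i → ∑ (λ j → λ' j i) ≡ q i)

-- The points (e_j , e_i) with E j i ≡ true are affinely independent.
AffinelyIndependent : ∀ {d} → VertexSet d → Set
AffinelyIndependent {d} E =
  (μ : Fin d → Fin d → ℚ) →
  (∀ j i → E j i ≡ false → μ j i ≡ 0ℚ) →
  ∑ (λ j → ∑ (λ i → μ j i)) ≡ 0ℚ →
  (∀ j → ∑ (λ i → μ j i) ≡ 0ℚ) →
  (∀ i → ∑ (λ j → μ j i) ≡ 0ℚ) →
  ∀ j i → μ j i ≡ 0ℚ

full : ∀ {d} → VertexSet d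
full j i = true

-- A triangulation Σ (given by its maximal simplices, i.e. a family of
-- vertex sets) of Δ_{d-1} × Δ_{d-1} using only its vertices.
record IsTriangulation {d : ℕ} (𝒯 : VertexSet d → Set) : Set₁ where
  field
    simplex   : ∀ σ → 𝒯 σ → AffinelyIndependent σ
    covers    : ∀ p → InConv full p → Σ (VertexSet d) λ σ → 𝒯 σ × InConv σ p
    intersect : ∀ σ τ → 𝒯 σ → 𝒯 τ → ∀ p → InConv σ p → InConv τ p →
                InConv (σ ∧ˢ τ) p

IsCell : ∀ {d} → (VertexSet d → Set) → VertexSet d → Set
IsCell {d} 𝒯 F = Σ (VertexSet d) λ σ → 𝒯 σ × F ⊆ σ

-- F is the minimal cell (w.r.t. inclusion) of 𝒯 containing p.
-- (Every subset of a cell is a cell, so minimality among cells means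
-- no proper subset of F contains p in its convex hull.)
MinimalCellContaining : ∀ {d} → (VertexSet d → Set) → Point d → VertexSet d → Set
MinimalCellContaining {d} 𝒯 p F =
  IsCell 𝒯 F × InConv F p ×
  (∀ F' → IsCell 𝒯 F' → F' ⊆ F → InConv F' p → F ⊆ F')

barycentre : (d : ℕ) → .{{_ : NonZero d}} → Point d
barycentre d = (λ _ → (+ 1) / d) , (λ _ → (+ 1) / d)

IsPerfectMatching : ∀ {d} → VertexSet d → Set
IsPerfectMatching {d} E =
  (∀ j → Σ (Fin d) λ i → E j i ≡ true × (∀ i' → E j i' ≡ true → i' ≡ i)) ×
  (∀ i → Σ (Fin d) λ j → E j i ≡ true × (∀ j' → E j' i ≡ true → j' ≡ j))

-- A point p of conv{(e_j , e_i)} is given by a nonnegative d × d matrix λ of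
-- barycentric coefficients; its row sums form the first block of p, its column
-- sums the second block.

module Submission where

open import Defs
open import Data.Nat as ℕ using (ℕ; NonZero)
import Data.Nat.Properties as ℕ
open import Data.Fin using (Fin; zero; suc; toℕ; fromℕ<)
open import Data.Fin.Properties
  using (any?; pigeonhole; toℕ-fromℕ<; toℕ<n; suc-injective)
  renaming (_≟_ to _≟ᶠ_)
import Data.Integer as ℤ
import Data.Integer.Properties as ℤ
import Data.Integer.Solver as ℤ-Solver
open import Data.Rational using (ℚ; 0ℚ; 1ℚ; _+_; _*_; _-_; _≤_; _<_; _/_; toℚᵘ)
open import Data.Rational.Properties
import Data.Rational.Unnormalised as ℚᵘ
import Data.Rational.Unnormalised.Properties as ℚᵘ
open import Data.Rational.Solver using (module +-*-Solver)
open import Algebra.Properties.Group +-0-group using (x∙y⁻¹≈ε⇒x≈y)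
import Data.Bool as Bool
open Bool using (Bool; true; false)
open import Data.Bool.Properties using (¬-not)
open import Data.Product using (Σ; _×_; _,_; proj₁; proj₂)
open import Data.Sum using (_⊎_; inj₁; inj₂)
open import Relation.Nullary using (¬_; does; yes; no; contradiction)
open import Relation.Nullary.Decidable using (_×-dec_; ¬?)
open import Relation.Binary.PropositionalEquality
open import Function using (_∘_)

open +-*-Solver using (solve; _:+_; _:-_; _:=_)

∑-cong : ∀ {n} {f g : Fin n → ℚ} → (∀ i → f i ≡ g i) → ∑ f ≡ ∑ g
∑-cong {ℕ.zero}  f≡g = refl
∑-cong {ℕ.suc n} f≡g = cong₂ _+_ (f≡g zero) (∑-cong (λ i → f≡g (suc i)))

∑-zero : ∀ {n} {f : Fin n → ℚ} → (∀ i → f i ≡ 0ℚ) → ∑ f ≡ 0ℚ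
∑-zero {ℕ.zero}  f≡0 = refl
∑-zero {ℕ.suc n} f≡0 =
  trans (cong₂ _+_ (f≡0 zero) (∑-zero (λ i → f≡0 (suc i)))) (+-identityˡ 0ℚ)

∑-+ : ∀ {n} (f g : Fin n → ℚ) → ∑ (λ i → f i + g i) ≡ ∑ f + ∑ g
∑-+ {ℕ.zero}  f g = refl
∑-+ {ℕ.suc n} f g =
  trans (cong (f zero + g zero +_) (∑-+ (λ i → f (suc i)) (λ i → g (suc i))))
        (solve 4 (λ a b s t → (a :+ b) :+ (s :+ t) := (a :+ s) :+ (b :+ t)) refl
               (f zero) (g zero) _ _)

∑-- : ∀ {n} (f g : Fin n → ℚ) → ∑ (λ i → f i - g i) ≡ ∑ f - ∑ g
∑-- {ℕ.zero}  f g = refl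
∑-- {ℕ.suc n} f g =
  trans (cong (f zero - g zero +_) (∑-- (λ i → f (suc i)) (λ i → g (suc i))))
        (solve 4 (λ a b s t → (a :- b) :+ (s :- t) := (a :+ s) :- (b :+ t)) refl
               (f zero) (g zero) _ _)

∑-*ˡ : ∀ {n} (c : ℚ) (f : Fin n → ℚ) → ∑ (λ i → c * f i) ≡ c * ∑ f
∑-*ˡ {ℕ.zero}  c f = sym (*-zeroʳ c)
∑-*ˡ {ℕ.suc n} c f =
  trans (cong (c * f zero +_) (∑-*ˡ c (λ i → f (suc i))))
        (sym (*-distribˡ-+ c (f zero) _))

∑-*ʳ : ∀ {n} (c : ℚ) (f : Fin n → ℚ) → ∑ (λ i → f i * c) ≡ ∑ f * c
∑-*ʳ c f = trans (∑-cong (λ i → *-comm (f i) c)) (trans (∑-*ˡ c f) (*-comm c (∑ f)))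

∑-point : ∀ {n} (f : Fin n → ℚ) (x : Fin n) → (∀ i → i ≢ x → f i ≡ 0ℚ) → ∑ f ≡ f x
∑-point {ℕ.suc n} f zero others =
  trans (cong (f zero +_) (∑-zero (λ i → others (suc i) λ ())))
        (+-identityʳ (f zero))
∑-point {ℕ.suc n} f (suc x) others =
  trans (cong₂ _+_ (others zero λ ())
                   (∑-point (λ i → f (suc i)) x (λ i i≢x → others (suc i) (i≢x ∘ suc-injective))))
        (+-identityˡ (f (suc x)))

∑-nonneg : ∀ {n} (f : Fin n → ℚ) → (∀ i → 0ℚ ≤ f i) → 0ℚ ≤ ∑ f
∑-nonneg {ℕ.zero}  f f≥0 = ≤-refl
∑-nonneg {ℕ.suc n} f f≥0 = +-mono-≤ (f≥0 zero) (∑-nonneg (λ i → f (suc i)) (λ i → f≥0 (suc i)))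

term≤∑ : ∀ {n} (f : Fin n → ℚ) → (∀ i → 0ℚ ≤ f i) → ∀ k → f k ≤ ∑ f
term≤∑ {ℕ.suc n} f f≥0 zero =
  subst (_≤ ∑ f) (+-identityʳ (f zero))
        (+-monoʳ-≤ (f zero) (∑-nonneg (λ i → f (suc i)) (λ i → f≥0 (suc i))))
term≤∑ {ℕ.suc n} f f≥0 (suc k) =
  subst (_≤ ∑ f) (+-identityˡ (f (suc k)))
        (+-mono-≤ (f≥0 zero) (term≤∑ (λ i → f (suc i)) (λ i → f≥0 (suc i)) k))

two-terms≤∑ : ∀ {n} (f : Fin n → ℚ) → (∀ i → 0ℚ ≤ f i) →
  ∀ k k' → k ≢ k' → f k + f k' ≤ ∑ f
two-terms≤∑ {ℕ.suc n} f f≥0 zero zero k≢k' = contradiction refl k≢k'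
two-terms≤∑ {ℕ.suc n} f f≥0 zero (suc k') _ =
  +-monoʳ-≤ (f zero) (term≤∑ (λ i → f (suc i)) (λ i → f≥0 (suc i)) k')
two-terms≤∑ {ℕ.suc n} f f≥0 (suc k) zero _ =
  subst (_≤ ∑ f) (+-comm (f zero) (f (suc k)))
        (+-monoʳ-≤ (f zero) (term≤∑ (λ i → f (suc i)) (λ i → f≥0 (suc i)) k))
two-terms≤∑ {ℕ.suc n} f f≥0 (suc k) (suc k') k≢k' =
  subst (_≤ ∑ f) (+-identityˡ _)
        (+-mono-≤ (f≥0 zero)
                  (two-terms≤∑ (λ i → f (suc i)) (λ i → f≥0 (suc i)) k k' (k≢k' ∘ cong suc)))

∑< : ℕ → (ℕ → ℚ) → ℚ
∑< ℕ.zero    g = 0ℚ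
∑< (ℕ.suc n) g = ∑< n g + g n

∑<-cong : ∀ n {g h : ℕ → ℚ} → (∀ k → g k ≡ h k) → ∑< n g ≡ ∑< n h
∑<-cong ℕ.zero    g≡h = refl
∑<-cong (ℕ.suc n) g≡h = cong₂ _+_ (∑<-cong n g≡h) (g≡h n)

∑<-zero : ∀ n (g : ℕ → ℚ) → (∀ k → k ℕ.< n → g k ≡ 0ℚ) → ∑< n g ≡ 0ℚ
∑<-zero ℕ.zero    g g≡0 = refl
∑<-zero (ℕ.suc n) g g≡0 =
  trans (cong₂ _+_ (∑<-zero n g (λ k k<n → g≡0 k (ℕ.m<n⇒m<1+n k<n))) (g≡0 n (ℕ.n<1+n n)))
        (+-identityˡ 0ℚ)

∑<-point : ∀ n (g : ℕ → ℚ) m → m ℕ.< n → (∀ k → k ℕ.< n → k ≢ m → g k ≡ 0ℚ) → ∑< n g ≡ g m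
∑<-point (ℕ.suc n) g m m<1+n others with ℕ.m<1+n⇒m<n∨m≡n m<1+n
... | inj₂ refl =
  trans (cong (_+ g m) (∑<-zero n g (λ k k<n → others k (ℕ.m<n⇒m<1+n k<n) (ℕ.<⇒≢ k<n))))
        (+-identityˡ (g m))
... | inj₁ m<n =
  trans (cong₂ _+_ (∑<-point n g m m<n (λ k k<n → others k (ℕ.m<n⇒m<1+n k<n)))
                   (others n (ℕ.n<1+n n) (ℕ.<⇒≢ m<n ∘ sym)))
        (+-identityʳ (g m))

∑-∑< : ∀ {d} n (h : Fin d → ℕ → ℚ) → ∑ (λ i → ∑< n (h i)) ≡ ∑< n (λ k → ∑ (λ i → h i k))
∑-∑< {d} ℕ.zero    h = ∑-zero {d} (λ _ → refl)
∑-∑< {d} (ℕ.suc n) h =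
  trans (∑-+ (λ i → ∑< n (h i)) (λ i → h i n)) (cong (_+ ∑ (λ i → h i n)) (∑-∑< n h))

telescope : ∀ n (a : ℕ → ℚ) → ∑< n (λ k → a k - a (ℕ.suc k)) ≡ a 0 - a n
telescope ℕ.zero    a = sym (+-inverseʳ (a 0))
telescope (ℕ.suc n) a =
  trans (cong (_+ (a n - a (ℕ.suc n))) (telescope n a))
        (solve 3 (λ x y z → (x :- y) :+ (y :- z) := x :- z) refl (a 0) (a n) (a (ℕ.suc n)))

δ : ∀ {d} → Fin d → Fin d → ℚ
δ x y with x ≟ᶠ y
... | yes _ = 1ℚ
... | no  _ = 0ℚ

δ-diag : ∀ {d} (x : Fin d) → δ x x ≡ 1ℚ
δ-diag x with x ≟ᶠ x
... | yes _   = refl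
... | no  x≢x = contradiction refl x≢x

δ-off : ∀ {d} {x y : Fin d} → x ≢ y → δ x y ≡ 0ℚ
δ-off {x = x} {y} x≢y with x ≟ᶠ y
... | yes x≡y = contradiction x≡y x≢y
... | no  _   = refl

δ-sym : ∀ {d} (x y : Fin d) → δ x y ≡ δ y x
δ-sym x y with x ≟ᶠ y
... | yes x≡y = sym (trans (cong (δ y) x≡y) (δ-diag y))
... | no  x≢y = sym (δ-off (x≢y ∘ sym))

∑-δ : ∀ {d} (x : Fin d) → ∑ (δ x) ≡ 1ℚ
∑-δ x = trans (∑-point (δ x) x (λ i i≢x → δ-off (i≢x ∘ sym))) (δ-diag x)

*δ-nonneg : ∀ {d} {c} → 0ℚ ≤ c → (x y : Fin d) → 0ℚ ≤ c * δ x y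
*δ-nonneg {c = c} 0≤c x y with x ≟ᶠ y
... | yes _ = subst (0ℚ ≤_) (sym (*-identityʳ c)) 0≤c
... | no  _ = subst (0ℚ ≤_) (sym (*-zeroʳ c)) ≤-refl

δ-annihilates : ∀ {d} (x y : Fin d) (a : ℚ) → (x ≡ y → a ≡ 0ℚ) → δ x y * a ≡ 0ℚ
δ-annihilates x y a a≡0 with x ≟ᶠ y
... | yes x≡y = trans (cong (1ℚ *_) (a≡0 x≡y)) (*-zeroʳ 1ℚ)
... | no  _   = *-zeroˡ a

-- Closed alternating walks in F give affine dependencies among its vertices

InjectiveBelow : ∀ {A : Set} → (ℕ → A) → ℕ → Set
InjectiveBelow J n = ∀ x y → x ℕ.< n → y ℕ.< n → J x ≡ J y → x ≡ y

-- A closed walk J 0, I 0, J 1, I 1, …, J n = J 0 alternating between rows and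
-- columns along edges (J k , I k) and (J (k+1) , I k) of F, without repeated rows
-- before closing and with I 1 ≢ I 0, yields the dependency
-- μ = ∑ₖ e_{I k} ⊗ (e_{J k} − e_{J (k+1)}), which is 1 at (J 1 , I 1).
closed-walk-dependent : ∀ {d} (F : VertexSet d) n (J I : ℕ → Fin d) →
  2 ℕ.≤ n → J n ≡ J 0 → InjectiveBelow J n → I 1 ≢ I 0 →
  (∀ k → k ℕ.< n → F (J k) (I k) ≡ true) →
  (∀ k → k ℕ.< n → F (J (ℕ.suc k)) (I k) ≡ true) →
  ¬ AffinelyIndependent F
closed-walk-dependent {d} F n J I 1<n closed distinct I₁≢I₀ edge edge' independent =
  1≢0 (trans (sym μ-at-J₁I₁) (independent μ μ-supported μ-total μ-rows μ-cols (J 1) (I 1)))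
  where
  open ≡-Reasoning

  step : ℕ → Fin d → Fin d → ℚ
  step k j i = δ (I k) i * (δ (J k) j - δ (J (ℕ.suc k)) j)

  μ : Fin d → Fin d → ℚ
  μ j i = ∑< n (λ k → step k j i)

  μ-rows : ∀ j → ∑ (λ i → μ j i) ≡ 0ℚ
  μ-rows j = begin
    ∑ (λ i → μ j i)                             ≡⟨ ∑-∑< n (λ i k → step k j i) ⟩
    ∑< n (λ k → ∑ (λ i → step k j i))           ≡⟨ ∑<-cong n row-sum ⟩
    ∑< n (λ k → δ (J k) j - δ (J (ℕ.suc k)) j)  ≡⟨ telescope n (λ k → δ (J k) j) ⟩
    δ (J 0) j - δ (J n) j                       ≡⟨ cong (λ x → δ (J 0) j - δ x j) closed ⟩
    δ (J 0) j - δ (J 0) j                       ≡⟨ +-inverseʳ (δ (J 0) j) ⟩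
    0ℚ                                          ∎
    where
    row-sum : ∀ k → ∑ (λ i → step k j i) ≡ δ (J k) j - δ (J (ℕ.suc k)) j
    row-sum k = begin
      ∑ (λ i → δ (I k) i * a)  ≡⟨ ∑-*ʳ a (δ (I k)) ⟩
      ∑ (δ (I k)) * a          ≡⟨ cong (_* a) (∑-δ (I k)) ⟩
      1ℚ * a                   ≡⟨ *-identityˡ a ⟩
      a                        ∎
      where a = δ (J k) j - δ (J (ℕ.suc k)) j

  μ-cols : ∀ i → ∑ (λ j → μ j i) ≡ 0ℚ
  μ-cols i = begin
    ∑ (λ j → μ j i)                    ≡⟨ ∑-∑< n (λ j k → step k j i) ⟩
    ∑< n (λ k → ∑ (λ j → step k j i))  ≡⟨ ∑<-cong n column-sum ⟩
    ∑< n (λ _ → 0ℚ)                    ≡⟨ ∑<-zero n _ (λ _ _ → refl) ⟩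
    0ℚ                                 ∎
    where
    column-sum : ∀ k → ∑ (λ j → step k j i) ≡ 0ℚ
    column-sum k = begin
      ∑ (λ j → step k j i)                                   ≡⟨ ∑-*ˡ (δ (I k) i) (λ j → δ (J k) j - δ (J (ℕ.suc k)) j) ⟩
      δ (I k) i * ∑ (λ j → δ (J k) j - δ (J (ℕ.suc k)) j)    ≡⟨ cong (δ (I k) i *_) (∑-- (δ (J k)) (δ (J (ℕ.suc k)))) ⟩
      δ (I k) i * (∑ (δ (J k)) - ∑ (δ (J (ℕ.suc k))))        ≡⟨ cong (δ (I k) i *_)
                                                                  (cong₂ _-_ (∑-δ (J k)) (∑-δ (J (ℕ.suc k)))) ⟩
      δ (I k) i * 0ℚ                                         ≡⟨ *-zeroʳ (δ (I k) i) ⟩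
      0ℚ                                                     ∎

  μ-total : ∑ (λ j → ∑ (λ i → μ j i)) ≡ 0ℚ
  μ-total = ∑-zero μ-rows

  -- Step k only involves the vertices (J k , I k) and (J (k+1) , I k) of F.
  μ-supported : ∀ j i → F j i ≡ false → μ j i ≡ 0ℚ
  μ-supported j i Fji≡false = ∑<-zero n _ λ k k<n → δ-annihilates (I k) i _ λ Ik≡i →
      cong₂ _-_ (δ-off (row-differs (subst (λ z → F (J k) z ≡ true) Ik≡i (edge k k<n))))
                (δ-off (row-differs (subst (λ z → F (J (ℕ.suc k)) z ≡ true) Ik≡i (edge' k k<n))))
    where
    row-differs : ∀ {j'} → F j' i ≡ true → j' ≢ j
    row-differs Fj'i refl with trans (sym Fj'i) Fji≡false
    ... | ()

  J≢J₁ : ∀ m → m ℕ.≤ n → m ≢ 1 → J m ≢ J 1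
  J≢J₁ m m≤n m≢1 Jm≡J₁ with ℕ.m≤n⇒m<n∨m≡n m≤n
  ... | inj₁ m<n  = m≢1 (distinct m 1 m<n 1<n Jm≡J₁)
  ... | inj₂ refl = ℕ.0≢1+n (distinct 0 1 (ℕ.<-trans ℕ.z<s 1<n) 1<n (trans (sym closed) Jm≡J₁))

  μ-at-J₁I₁ : μ (J 1) (I 1) ≡ 1ℚ
  μ-at-J₁I₁ = trans (∑<-point n _ 1 1<n other-steps) step-1
    where
    other-steps : ∀ k → k ℕ.< n → k ≢ 1 → step k (J 1) (I 1) ≡ 0ℚ
    other-steps 0 _ _ =
      trans (cong (_* (δ (J 0) (J 1) - δ (J 1) (J 1))) (δ-off (I₁≢I₀ ∘ sym)))
            (*-zeroˡ (δ (J 0) (J 1) - δ (J 1) (J 1)))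
    other-steps 1 _ 1≢1 = contradiction refl 1≢1
    other-steps (ℕ.suc (ℕ.suc k)) k<n _ =
      trans (cong (δ (I (2 ℕ.+ k)) (I 1) *_)
                  (cong₂ _-_ (δ-off (J≢J₁ (2 ℕ.+ k) (ℕ.<⇒≤ k<n) λ ()))
                             (δ-off (J≢J₁ (3 ℕ.+ k) k<n λ ()))))
            (*-zeroʳ (δ (I (2 ℕ.+ k)) (I 1)))
    step-1 : step 1 (J 1) (I 1) ≡ 1ℚ
    step-1 = begin
      δ (I 1) (I 1) * (δ (J 1) (J 1) - δ (J 2) (J 1))
        ≡⟨ cong₂ (λ a b → a * (b - δ (J 2) (J 1))) (δ-diag (I 1)) (δ-diag (J 1)) ⟩
      1ℚ * (1ℚ - δ (J 2) (J 1))
        ≡⟨ cong (λ c → 1ℚ * (1ℚ - c)) (δ-off (J≢J₁ 2 1<n λ ())) ⟩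
      1ℚ * (1ℚ - 0ℚ)
        ≡⟨⟩
      1ℚ ∎

FirstRepetition : ∀ {d} → (ℕ → Fin d) → Set
FirstRepetition J = Σ ℕ λ a → Σ ℕ λ b → a ℕ.< b × J a ≡ J b × InjectiveBelow J b

injective-or-repeats : ∀ {d} (J : ℕ → Fin d) m → InjectiveBelow J m ⊎ FirstRepetition J
injective-or-repeats J ℕ.zero = inj₁ (λ _ _ ())
injective-or-repeats J (ℕ.suc m) with injective-or-repeats J m
... | inj₂ repetition = inj₂ repetition
... | inj₁ injective with any? (λ (a : Fin m) → J (toℕ a) ≟ᶠ J m)
...   | yes (a , Ja≡Jm) = inj₂ (toℕ a , m , toℕ<n a , Ja≡Jm , injective)
...   | no  seen        = inj₁ extended
  where
  fresh : ∀ x → x ℕ.< m → J x ≢ J m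
  fresh x x<m Jx≡Jm = seen (fromℕ< x<m , trans (cong J (toℕ-fromℕ< x<m)) Jx≡Jm)

  extended : InjectiveBelow J (ℕ.suc m)
  extended x y x<1+m y<1+m Jx≡Jy with ℕ.m<1+n⇒m<n∨m≡n x<1+m | ℕ.m<1+n⇒m<n∨m≡n y<1+m
  ... | inj₁ x<m  | inj₁ y<m  = injective x y x<m y<m Jx≡Jy
  ... | inj₁ x<m  | inj₂ refl = contradiction Jx≡Jy (fresh x x<m)
  ... | inj₂ refl | inj₁ y<m  = contradiction (sym Jx≡Jy) (fresh y y<m)
  ... | inj₂ refl | inj₂ refl = refl

first-repetition : ∀ {d} (J : ℕ → Fin d) → FirstRepetition J
first-repetition {d} J with injective-or-repeats J (ℕ.suc d)
... | inj₂ repetition = repetition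
... | inj₁ injective with pigeonhole (ℕ.n<1+n d) (λ x → J (toℕ x))
...   | x , y , x<y , Jx≡Jy =
  contradiction (injective (toℕ x) (toℕ y) (toℕ<n x) (toℕ<n y) Jx≡Jy) (ℕ.<⇒≢ x<y)

first-return : ∀ {d} (J : ℕ → Fin d) →
  Σ ℕ λ a → Σ ℕ λ n →
    0 ℕ.< n × J (n ℕ.+ a) ≡ J a × InjectiveBelow (λ k → J (k ℕ.+ a)) n
first-return J with first-repetition J
... | a , b , a<b , Ja≡Jb , injective =
  a , b ℕ.∸ a , ℕ.m<n⇒0<n∸m a<b , trans (cong J n+a≡b) (sym Ja≡Jb) , shifted-injective
  where
  n+a≡b : b ℕ.∸ a ℕ.+ a ≡ b
  n+a≡b = ℕ.m∸n+n≡m (ℕ.<⇒≤ a<b)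

  shift : ∀ x → x ℕ.< b ℕ.∸ a → x ℕ.+ a ℕ.< b
  shift x x<n = subst (x ℕ.+ a ℕ.<_) n+a≡b (ℕ.+-monoˡ-< a x<n)

  shifted-injective : InjectiveBelow (λ k → J (k ℕ.+ a)) (b ℕ.∸ a)
  shifted-injective x y x<n y<n Jx≡Jy =
    ℕ.+-cancelʳ-≡ a x y (injective (x ℕ.+ a) (y ℕ.+ a) (shift x x<n) (shift y y<n) Jx≡Jy)

-- Balanced matrices supported on affinely independent sets are matchings

nonzero⇒member : ∀ {A : Set} (E : A → Bool) (f : A → ℚ) →
  (∀ a → E a ≡ false → f a ≡ 0ℚ) → ∀ a → f a ≢ 0ℚ → E a ≡ true
nonzero⇒member E f outside a fa≢0 with E a in Ea
... | true  = refl
... | false = contradiction (outside a Ea) fa≢0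

nonneg-nonzero⇒pos : ∀ {x} → 0ℚ ≤ x → x ≢ 0ℚ → 0ℚ < x
nonneg-nonzero⇒pos {x} 0≤x x≢0 with x ≤? 0ℚ
... | yes x≤0 = contradiction (≤-antisym x≤0 0≤x) x≢0
... | no  x≰0 = ≰⇒> x≰0

Fractional : ℚ → ℚ → Set
Fractional c x = 0ℚ < x × x < c

-- In a nonnegative line with sum c, a fractional entry is accompanied by another
-- one (otherwise the line would consist of that entry alone, which then equals c).
another-fractional : ∀ {n} (f : Fin n → ℚ) {c} → (∀ i → 0ℚ ≤ f i) → ∑ f ≡ c →
  ∀ k → Fractional c (f k) → Σ (Fin n) λ k' → k' ≢ k × Fractional c (f k')
another-fractional f {c} f≥0 ∑f≡c k (0<fk , fk<c)
  with any? (λ i → ¬? (i ≟ᶠ k) ×-dec (0ℚ <? f i))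
... | yes (k' , k'≢k , 0<fk') = k' , k'≢k , 0<fk' , fk'<c
  where
  fk'<c : f k' < c
  fk'<c = <-≤-trans (subst (_< f k + f k') (+-identityˡ (f k')) (+-monoˡ-< (f k') 0<fk))
                    (subst (f k + f k' ≤_) ∑f≡c (two-terms≤∑ f f≥0 k k' (k'≢k ∘ sym)))
... | no none = contradiction fk≡c (<⇒≢ fk<c)
  where
  others-vanish : ∀ i → i ≢ k → f i ≡ 0ℚ
  others-vanish i i≢k = ≤-antisym (≮⇒≥ (λ 0<fi → none (i , i≢k , 0<fi))) (f≥0 i)

  fk≡c : f k ≡ c
  fk≡c = trans (sym (∑-point f k others-vanish)) ∑f≡c

module FractionalWalk {d} (lam : Fin d → Fin d → ℚ) {c : ℚ} (lam≥0 : ∀ j i → 0ℚ ≤ lam j i)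
  (rows : ∀ j → ∑ (lam j) ≡ c) (cols : ∀ i → ∑ (λ j → lam j i) ≡ c) where

  FractionalEntry : Set
  FractionalEntry = Σ (Fin d) λ j → Σ (Fin d) λ i → Fractional c (lam j i)

  record Move (j i : Fin d) : Set where
    field
      j' i'  : Fin d
      j'≢j   : j' ≢ j
      i'≢i   : i' ≢ i
      via    : Fractional c (lam j' i)
      target : Fractional c (lam j' i')

  move : ∀ {j i} → Fractional c (lam j i) → Move j i
  move {j} {i} frac
    with another-fractional (λ j → lam j i) (λ j → lam≥0 j i) (cols i) j frac
  ... | j' , j'≢j , via with another-fractional (lam j') (lam≥0 j') (rows j') i via
  ...   | i' , i'≢i , target = record
    { j' = j' ; i' = i' ; j'≢j = j'≢j ; i'≢i = i'≢i ; via = via ; target = target }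

  next : FractionalEntry → FractionalEntry
  next (j , i , frac) = Move.j' m , Move.i' m , Move.target m
    where m = move frac

  module Walk (start : FractionalEntry) where
    walk : ℕ → FractionalEntry
    walk ℕ.zero    = start
    walk (ℕ.suc k) = next (walk k)

    row col : ℕ → Fin d
    row k = proj₁ (walk k)
    col k = proj₁ (proj₂ (walk k))

    at : ∀ k → Fractional c (lam (row k) (col k))
    at k = proj₂ (proj₂ (walk k))

    via : ∀ k → Fractional c (lam (row (ℕ.suc k)) (col k))
    via k = Move.via (move (at k))

    row-moves : ∀ k → row (ℕ.suc k) ≢ row k
    row-moves k = Move.j'≢j (move (at k))

    col-moves : ∀ k → col (ℕ.suc k) ≢ col k
    col-moves k = Move.i'≢i (move (at k))

  -- If λ vanishes outside an affinely independent F, no entry of λ is fractional: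
  -- the walk from a fractional entry returns to an earlier row, and the closed part
  -- of the walk is a closed walk in F, contradicting closed-walk-dependent.
  no-fractional-entry : (F : VertexSet d) → AffinelyIndependent F →
    (∀ j i → F j i ≡ false → lam j i ≡ 0ℚ) → ∀ j i → ¬ Fractional c (lam j i)
  no-fractional-entry F independent outside j i frac
    with first-return (Walk.row (j , i , frac))
  ... | a , n , 0<n , closes , distinct =
    closed-walk-dependent F n (λ k → row (k ℕ.+ a)) (λ k → col (k ℕ.+ a))
      2≤n closes distinct (col-moves a)
      (λ k _ → in-F (at (k ℕ.+ a))) (λ k _ → in-F (via (k ℕ.+ a))) independent
    where
    open Walk (j , i , frac)

    in-F : ∀ {j' i'} → Fractional c (lam j' i') → F j' i' ≡ true
    in-F {j'} {i'} (0<x , _) = nonzero⇒member (F j') (lam j') (outside j') i' (<⇒≢ 0<x ∘ sym)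

    -- A return after one step would repeat a row in consecutive entries.
    2≤n : 2 ℕ.≤ n
    2≤n = ℕ.≤∧≢⇒< 0<n λ 1≡n →
      row-moves a (subst (λ m → row (m ℕ.+ a) ≡ row a) (sym 1≡n) closes)

-- A line of nonnegative entries with sum c > 0, vanishing off E and equal to c on
-- E, meets E exactly once (two entries c would already sum to more than c).
single-in-line : ∀ {n} (E : Fin n → Bool) (f : Fin n → ℚ) {c} → 0ℚ < c →
  (∀ i → 0ℚ ≤ f i) → (∀ i → E i ≡ false → f i ≡ 0ℚ) → (∀ i → E i ≡ true → f i ≡ c) →
  ∑ f ≡ c → Σ (Fin n) λ i → E i ≡ true × (∀ i' → E i' ≡ true → i' ≡ i)
single-in-line E f {c} 0<c f≥0 outside inside ∑f≡c with any? (λ i → E i Bool.≟ true)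
... | no none =
  contradiction (trans (sym (∑-zero λ i → outside i (¬-not (none ∘ (i ,_))))) ∑f≡c) (<⇒≢ 0<c)
... | yes (i , Ei) = i , Ei , unique
  where
  unique : ∀ i' → E i' ≡ true → i' ≡ i
  unique i' Ei' with i' ≟ᶠ i
  ... | yes i'≡i = i'≡i
  ... | no  i'≢i = contradiction (≤-<-trans c+c≤c c<c+c) (<-irrefl refl)
    where
    c+c≤c : c + c ≤ c
    c+c≤c = subst₂ (λ x y → x + y ≤ c) (inside i' Ei') (inside i Ei)
                   (subst (f i' + f i ≤_) ∑f≡c (two-terms≤∑ f f≥0 i' i i'≢i))

    c<c+c : c < c + c
    c<c+c = subst (_< c + c) (+-identityʳ c) (+-monoʳ-< c 0<c)

-- Let λ ≥ 0 be nonzero exactly on an affinely independent F, with all row and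
-- column sums c > 0.  By no-fractional-entry every entry on F equals c, so each
-- row and each column meets F exactly once.
balanced-support-is-matching : ∀ {d} (F : VertexSet d) → AffinelyIndependent F →
  (lam : Fin d → Fin d → ℚ) → (∀ j i → 0ℚ ≤ lam j i) →
  (∀ j i → F j i ≡ false → lam j i ≡ 0ℚ) → (∀ j i → F j i ≡ true → lam j i ≢ 0ℚ) →
  ∀ {c} → 0ℚ < c → (∀ j → ∑ (lam j) ≡ c) → (∀ i → ∑ (λ j → lam j i) ≡ c) →
  IsPerfectMatching F
balanced-support-is-matching F independent lam lam≥0 outside nonzero {c} 0<c rows cols =
  (λ j → single-in-line (F j) (lam j) 0<c (lam≥0 j) (outside j) (on-F j) (rows j)) ,
  (λ i → single-in-line (λ j → F j i) (λ j → lam j i) 0<c (λ j → lam≥0 j i)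
                        (λ j → outside j i) (λ j → on-F j i) (cols i))
  where
  open FractionalWalk lam lam≥0 rows cols using (no-fractional-entry)

  on-F : ∀ j i → F j i ≡ true → lam j i ≡ c
  on-F j i Fji = ≤-antisym (subst (lam j i ≤_) (rows j) (term≤∑ (lam j) (lam≥0 j) i))
    (≮⇒≥ λ lam<c → no-fractional-entry F independent outside j i
                     (nonneg-nonzero⇒pos (lam≥0 j i) (nonzero j i Fji) , lam<c))

-- Cells and barycentric coefficients

⊆-false : ∀ {d} {E F : VertexSet d} → E ⊆ F → ∀ j i → F j i ≡ false → E j i ≡ false
⊆-false {E = E} E⊆F j i Fji with E j i in Eji
... | true  = trans (sym (E⊆F j i Eji)) Fji
... | false = refl

independent-⊆ : ∀ {d} {E F : VertexSet d} → E ⊆ F → AffinelyIndependent F → AffinelyIndependent E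
independent-⊆ E⊆F independent μ outside = independent μ (λ j i → outside j i ∘ ⊆-false E⊆F j i)

InConv-⊆ : ∀ {d} {E F : VertexSet d} {p} → E ⊆ F → InConv E p → InConv F p
InConv-⊆ E⊆F (lam , lam≥0 , outside , sums) = lam , lam≥0 , (λ j i → outside j i ∘ ⊆-false E⊆F j i) , sums

cell-independent : ∀ {d} {𝒯 : VertexSet d → Set} {F} → IsTriangulation 𝒯 → IsCell 𝒯 F →
  AffinelyIndependent F
cell-independent tri (σ , σ∈𝒯 , F⊆σ) = independent-⊆ F⊆σ (IsTriangulation.simplex tri σ σ∈𝒯)

-- Coefficients with respect to an affinely independent set are unique: the
-- difference of two coefficient matrices of p is an affine dependency.
coefficients-unique : ∀ {d} {σ : VertexSet d} {p} → AffinelyIndependent σ →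
  (r r' : InConv σ p) → ∀ j i → proj₁ r j i ≡ proj₁ r' j i
coefficients-unique {p = p} independent
  (lam , _ , outside , total , rows , cols) (lam' , _ , outside' , total' , rows' , cols') j i =
  x∙y⁻¹≈ε⇒x≈y (lam j i) (lam' j i)
    (independent μ μ-outside μ-total μ-rows μ-cols j i)
  where
  μ : _ → _ → ℚ
  μ j i = lam j i - lam' j i

  μ-outside : ∀ j i → _ ≡ false → μ j i ≡ 0ℚ
  μ-outside j i σji = trans (cong₂ _-_ (outside j i σji) (outside' j i σji)) (+-inverseʳ 0ℚ)

  μ-rows : ∀ j → ∑ (μ j) ≡ 0ℚ
  μ-rows j = trans (∑-- (lam j) (lam' j)) (trans (cong₂ _-_ (rows j) (rows' j)) (+-inverseʳ (proj₁ p j)))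

  μ-cols : ∀ i → ∑ (λ j → μ j i) ≡ 0ℚ
  μ-cols i = trans (∑-- (λ j → lam j i) (λ j → lam' j i))
                   (trans (cong₂ _-_ (cols i) (cols' i)) (+-inverseʳ (proj₂ p i)))

  μ-total : ∑ (λ j → ∑ (μ j)) ≡ 0ℚ
  μ-total = trans (∑-cong λ j → ∑-- (lam j) (lam' j))
                  (trans (∑-- (λ j → ∑ (lam j)) (λ j → ∑ (lam' j)))
                         (trans (cong₂ _-_ total total') (+-inverseʳ 1ℚ)))

support : ∀ {d} → (Fin d → Fin d → ℚ) → VertexSet d
support lam j i = Bool.not (does (lam j i ≟ 0ℚ))

support-false : ∀ {d} (lam : Fin d → Fin d → ℚ) j i → support lam j i ≡ false → lam j i ≡ 0ℚ
support-false lam j i _  with lam j i ≟ 0ℚ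
support-false lam j i _  | yes lam≡0 = lam≡0
support-false lam j i () | no  _

support-true : ∀ {d} (lam : Fin d → Fin d → ℚ) j i → support lam j i ≡ true → lam j i ≢ 0ℚ
support-true lam j i _  with lam j i ≟ 0ℚ
support-true lam j i () | yes _
support-true lam j i _  | no  lam≢0 = lam≢0

support-⊆ : ∀ {d} {E : VertexSet d} {lam} → (∀ j i → E j i ≡ false → lam j i ≡ 0ℚ) →
  support lam ⊆ E
support-⊆ {E = E} {lam} outside j i in-support =
  nonzero⇒member (E j) (lam j) (outside j) i (support-true lam j i in-support)

InConv-support : ∀ {d} {E : VertexSet d} {p} (r : InConv E p) → InConv (support (proj₁ r)) p
InConv-support (lam , lam≥0 , _ , sums) = lam , lam≥0 , support-false lam , sums

-- If p has coefficients λ in a maximal simplex σ, then supp λ is the minimal cell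
-- containing p: coefficients of p in a cell F' ⊆ supp λ are also coefficients in
-- σ, hence equal to λ, so supp λ ⊆ F'.
support-is-minimal-cell : ∀ {d} {𝒯 : VertexSet d → Set} {σ p} → IsTriangulation 𝒯 →
  𝒯 σ → (r : InConv σ p) → MinimalCellContaining 𝒯 p (support (proj₁ r))
support-is-minimal-cell tri σ∈𝒯 r@(lam , _ , outside , _) =
  (_ , σ∈𝒯 , support⊆σ) , InConv-support r , minimal
  where
  support⊆σ = support-⊆ outside

  minimal : ∀ F' → _ → F' ⊆ support lam → InConv F' _ → support lam ⊆ F'
  minimal F' _ F'⊆support r'@(lam' , _ , outside' , _) j i in-support =
    nonzero⇒member (F' j) (lam' j) (outside' j) i
      (subst (_≢ 0ℚ) (coefficients-unique independent r r'-in-σ j i)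
             (support-true lam j i in-support))
    where
    independent = IsTriangulation.simplex tri _ σ∈𝒯
    r'-in-σ = InConv-⊆ (λ j i → support⊆σ j i ∘ F'⊆support j i) r'

-- On a minimal cell F containing p every coefficient of p is nonzero, since the
-- support of the coefficients is a cell inside F containing p.
minimal-cell-coefficients-nonzero : ∀ {d} {𝒯 : VertexSet d → Set} {F p} →
  IsCell 𝒯 F → (r : InConv F p) → (∀ F' → IsCell 𝒯 F' → F' ⊆ F → InConv F' p → F ⊆ F') →
  ∀ j i → F j i ≡ true → proj₁ r j i ≢ 0ℚ
minimal-cell-coefficients-nonzero (σ , σ∈𝒯 , F⊆σ) r@(lam , _ , outside , _) minimal j i Fji =
  support-true lam j i
    (minimal (support lam) (σ , σ∈𝒯 , λ j i → F⊆σ j i ∘ support⊆F j i)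
             support⊆F (InConv-support r) j i Fji)
  where support⊆F = support-⊆ outside

-- The barycentre of Δ_{d-1} × Δ_{d-1}, for d = d' + 1

module Barycentre (d' : ℕ) where
  d : ℕ
  d = ℕ.suc d'

  c : ℚ
  c = ℤ.+ 1 / d

  c-pos : 0ℚ < c
  c-pos = positive⁻¹ c {{normalize-pos 1 d}}

  ∑-copies : ∀ k → toℚᵘ (∑ {k} (λ _ → c)) ℚᵘ.≃ ℚᵘ.mkℚᵘ (ℤ.+ k) d'
  ∑-copies ℕ.zero    = ℚᵘ.*≡* refl
  ∑-copies (ℕ.suc k) = ℚᵘ.≃-trans (toℚᵘ-homo-+ c (∑ {k} (λ _ → c)))
    (ℚᵘ.≃-trans (ℚᵘ.+-cong (toℚᵘ-fromℚᵘ (ℚᵘ.mkℚᵘ (ℤ.+ 1) d')) (∑-copies k)) add-numerators)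
    where
    module Z = ℤ-Solver.+-*-Solver
    add-numerators : ℚᵘ.mkℚᵘ (ℤ.+ 1) d' ℚᵘ.+ ℚᵘ.mkℚᵘ (ℤ.+ k) d' ℚᵘ.≃ ℚᵘ.mkℚᵘ (ℤ.+ ℕ.suc k) d'
    add-numerators = ℚᵘ.*≡* (Z.solve 3
      (λ a b n → (a Z.:* n Z.:+ b Z.:* n) Z.:* n Z.:= (a Z.:+ b) Z.:* (n Z.:* n))
      refl (ℤ.+ 1) (ℤ.+ k) (ℤ.+ d))

  ∑-c : ∑ {d} (λ _ → c) ≡ 1ℚ
  ∑-c = toℚᵘ-injective (ℚᵘ.≃-trans (∑-copies d) (ℚᵘ.*≡* (ℤ.*-comm (ℤ.+ d) (ℤ.+ 1))))

  -- The barycentre has the diagonal coefficients c · δ, with all line sums c.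
  diagonal : InConv full (barycentre d)
  diagonal = (λ j i → c * δ j i) , *δ-nonneg (<⇒≤ c-pos) , (λ _ _ ()) ,
             trans (∑-cong diagonal-row) ∑-c , diagonal-row , diagonal-col
    where
    diagonal-row : ∀ j → ∑ (λ i → c * δ j i) ≡ c
    diagonal-row j = trans (∑-*ˡ c (δ j)) (trans (cong (c *_) (∑-δ j)) (*-identityʳ c))

    diagonal-col : ∀ i → ∑ (λ j → c * δ j i) ≡ c
    diagonal-col i = trans (∑-cong λ j → cong (c *_) (δ-sym j i)) (diagonal-row i)

proposition2p5 : (d : ℕ) → .{{_ : NonZero d}} →
    (𝒯 : VertexSet d → Set) → IsTriangulation 𝒯 →
    Σ (VertexSet d) (λ F → MinimalCellContaining 𝒯 (barycentre d) F) ×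
    (∀ F → MinimalCellContaining 𝒯 (barycentre d) F → IsPerfectMatching F)
proposition2p5 (ℕ.suc d') 𝒯 tri = minimal-cell , minimal-cells-are-matchings
  where
  open Barycentre d'

  minimal-cell : Σ (VertexSet d) (λ F → MinimalCellContaining 𝒯 (barycentre d) F)
  minimal-cell with IsTriangulation.covers tri (barycentre d) diagonal
  ... | σ , σ∈𝒯 , r = support (proj₁ r) , support-is-minimal-cell tri σ∈𝒯 r

  -- The coefficients of g on a minimal cell are nonzero exactly on it, and all
  -- their line sums equal 1/d.
  minimal-cells-are-matchings : ∀ F → MinimalCellContaining 𝒯 (barycentre d) F →
    IsPerfectMatching F
  minimal-cells-are-matchings F (cell , r@(lam , lam≥0 , outside , _ , rows , cols) , minimal) =
    balanced-support-is-matching F (cell-independent tri cell) lam lam≥0 outside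
      (minimal-cell-coefficients-nonzero cell r minimal) c-pos rows cols
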